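{- Let $n\ge 7$. If $S$ is a $k$-MARS of the wheel graph $W_{1,n-1}$ for some $k\ge 4$, then $0\in S$.
   Context: The wheel graph $W_{1,n-1}$ has vertex set $\{0,1,\dots,n-1\}$, where vertices $1,\dots,n-1$ induce the cycle $C_{n-1}$ (with $i$ adjacent to $i+1$ and $n-1$ adjacent to $1$) and vertex $0$ is adjacent to all of $1,\dots,n-1$. For a connected graph $G$, $S\subseteq V(G)$ and $v\in V(G)$, $m(v|S)$ is the multiset $\{\!\{d_G(v,s): s\in S\}\!\}$ of shortest-path distances. A nonempty set $S\subsetneq V(G)$ is a $k$-multiset antiresolving set ($k$-MARS) if $k$ equals the minimum size of an equivalence class of the relation on $V(G)\setminus S$ given by $u\sim v \iff m(u|S)=m(v|S)$. -}

module Defs where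

open import Data.Nat using (ℕ; zero; suc; _+_; _≤_; _<_)
import Data.Nat as ℕ
open import Data.Bool using (Bool; true; false; _∧_; _∨_; not; if_then_else_)
open import Data.Fin using (Fin; toℕ)
open import Data.Fin.Subset using (Subset; _∈_; _∉_; Nonempty)
open import Data.Fin.Subset.Properties using (_∈?_)
open import Data.List using (List; []; _∷_; length; filter; allFin)
open import Data.Bool.ListAction using (any)
open import Data.Vec using (Vec; tabulate)
open import Data.Vec.Properties using (≡-dec)
open import Data.Product using (∃; _×_; _,_)
open import Relation.Nullary using (¬_; does)
open import Relation.Nullary.Decidable using (⌊_⌋)
open import Relation.Binary.PropositionalEquality using (_≡_)

Graph : ℕ → Set
Graph n = Fin n → Fin n → Bool

-- Wheel graph W_{1,n-1}: vertex 0 is the hub, adjacent to 1..n-1;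
-- vertices 1..n-1 form the cycle C_{n-1} (i ~ i+1, and n-1 ~ 1).
wheelAdjℕ : ℕ → ℕ → ℕ → Bool
wheelAdjℕ n i j =
  (⌊ i ℕ.≟ 0 ⌋ ∧ not ⌊ j ℕ.≟ 0 ⌋)
  ∨ (⌊ j ℕ.≟ 0 ⌋ ∧ not ⌊ i ℕ.≟ 0 ⌋)
  ∨ (not ⌊ i ℕ.≟ 0 ⌋ ∧ not ⌊ j ℕ.≟ 0 ⌋ ∧
      (⌊ j ℕ.≟ suc i ⌋ ∨ ⌊ i ℕ.≟ suc j ⌋
       ∨ (⌊ i ℕ.≟ 1 ⌋ ∧ ⌊ suc j ℕ.≟ n ⌋)
       ∨ (⌊ j ℕ.≟ 1 ⌋ ∧ ⌊ suc i ℕ.≟ n ⌋)))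

wheel : (n : ℕ) → Graph n
wheel n i j = wheelAdjℕ n (toℕ i) (toℕ j)

within : ∀ {n} → Graph n → ℕ → Fin n → Fin n → Bool
within G zero    u v = ⌊ u Data.Fin.≟ v ⌋
within G (suc d) u v =
  ⌊ u Data.Fin.≟ v ⌋ ∨ any (λ w → G u w ∧ within G d w v) (allFin _)

distFrom : ∀ {n} → Graph n → ℕ → ℕ → Fin n → Fin n → ℕ
distFrom G d zero        u v = d
distFrom G d (suc fuel)  u v =
  if within G d u v then d else distFrom G (suc d) fuel u v

-- Shortest-path distance d_G(u,v) (for a connected graph on n vertices it is
-- < n; the value n is only returned for disconnected pairs).
dist : ∀ {n} → Graph n → Fin n → Fin n → ℕ
dist {n} G u v = distFrom G 0 n u v

elems : ∀ {n} → Subset n → List (Fin n)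
elems S = filter (λ x → x ∈? S) (allFin _)

-- Multiset m(v|S) of distances, represented by its multiplicity function on
-- the possible values 0..n: entry d = #{ s ∈ S : d_G(v,s) = d }.
mset : ∀ {n} → Graph n → Subset n → Fin n → Vec ℕ (suc n)
mset G S v =
  tabulate (λ d → length (filter (λ s → dist G v s ℕ.≟ toℕ d) (elems S)))

_~[_,_]_ : ∀ {n} → Fin n → Graph n → Subset n → Fin n → Set
u ~[ G , S ] v = mset G S u ≡ mset G S v

classSize : ∀ {n} → Graph n → Subset n → Fin n → ℕ
classSize G S v =
  length (filter (λ u → ≡-dec ℕ._≟_ (mset G S u) (mset G S v))
                 (filter (λ u → Relation.Nullary.Decidable.¬? (u ∈? S)) (allFin _)))

IsKMARS : ∀ {n} → Graph n → Subset n → ℕ → Set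
IsKMARS G S k =
  Nonempty S
  × (∃ λ x → x ∉ S)
  × (∃ λ v → v ∉ S × classSize G S v ≡ k)
  × (∀ v → v ∉ S → k ≤ classSize G S v)

-- If the hub is outside S, every vertex of S lies on the rim at distance 1 from the hub, so a
-- vertex with the same distance multiset as the hub is adjacent to every vertex of S. A rim
-- vertex has only three neighbours (the hub and its two cycle neighbours), hence the class of
-- the hub has at most 3 < k elements.
module Submission where

open import Defs
open import Data.Nat using (ℕ; _≤_)
open import Data.Fin using (Fin; toℕ)
open import Data.Fin.Subset using (Subset; _∈_)
open import Relation.Binary.PropositionalEquality using (_≡_)

open import Data.Bool using (true; false; T; _∧_)
open import Data.Bool.Properties using (T-∧; T-∨)
open import Data.Bool.ListAction using (any)
import Data.Fin as Fin
open import Data.Fin.Properties using (toℕ-injective; toℕ<n)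
open import Data.Fin.Subset using (_∉_)
open import Data.Fin.Subset.Properties using (_∈?_)
open import Data.List using (List; []; _∷_; _++_; length; filter; allFin; map)
open import Data.List.Properties using (length-++-sucʳ; length-map; filter-all; filter-complete)
open import Data.List.Membership.Propositional using () renaming (_∈_ to _∈ˡ_)
open import Data.List.Membership.Propositional.Properties
  using (∈-∃++; ∈-++⁻; ∈-++⁺ˡ; ∈-++⁺ʳ; ∈-filter⁺; ∈-filter⁻; ∈-allFin; ∈-map⁻)
open import Data.List.Relation.Binary.Subset.Propositional using (_⊆_)
open import Data.List.Relation.Unary.All as All using (All)
open import Data.List.Relation.Unary.AllPairs using ([]; _∷_)
open import Data.List.Relation.Unary.All.Properties using (all-filter)
import Data.List.Relation.Unary.Any as Any
open import Data.List.Relation.Unary.Any using (here; there; satisfied)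
open import Data.List.Relation.Unary.Any.Properties using (any⁺; any⁻)
open import Data.List.Relation.Unary.Unique.Propositional using (Unique)
import Data.List.Relation.Unary.Unique.Propositional.Properties as Unique
open import Data.Nat as ℕ using (zero; suc; pred; _<_; z≤n; s≤s)
open import Data.Nat.Properties using (≤-refl; ≤-trans; n≤1+n; <⇒≢; <⇒≱; module ≤-Reasoning)
open import Data.Product as Product using (_×_; ∃; _,_; proj₂)
open import Data.Sum using (_⊎_; inj₁; inj₂)
import Data.Vec as Vec
open import Data.Vec.Properties using (lookup∘tabulate; ≡-dec)
open import Function using (_∘_; Equivalence)
open import Relation.Nullary using (Dec; ¬?; yes; no; contradiction)
open import Relation.Nullary.Decidable using (decidable-stable; ⌊_⌋; toWitness; fromWitness)
open import Relation.Binary.PropositionalEquality using (module ≡-Reasoning; _≢_; refl; sym; trans; cong; subst)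

unique⊆⇒length≤ : ∀ {a} {A : Set a} {xs ys : List A} → Unique xs → xs ⊆ ys → length xs ≤ length ys
unique⊆⇒length≤ {xs = []} [] _ = z≤n
unique⊆⇒length≤ {xs = x ∷ xs} (x∉xs ∷ xs!) x∷xs⊆ys
  with as , bs , refl ← ∈-∃++ (x∷xs⊆ys (here refl)) = begin
    suc (length xs)          ≤⟨ s≤s (unique⊆⇒length≤ xs! xs⊆as++bs) ⟩
    suc (length (as ++ bs))  ≡⟨ sym (length-++-sucʳ as x bs) ⟩
    length (as ++ x ∷ bs)    ∎
  where
  open ≤-Reasoning
  xs⊆as++bs : xs ⊆ as ++ bs
  xs⊆as++bs y∈xs with ∈-++⁻ as (x∷xs⊆ys (there y∈xs))
  ... | inj₁ y∈as         = ∈-++⁺ˡ y∈as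
  ... | inj₂ (here refl)  = contradiction refl (All.lookup x∉xs y∈xs)
  ... | inj₂ (there y∈bs) = ∈-++⁺ʳ as y∈bs

start≤distFrom : ∀ {n} (G : Graph n) d fuel u v → d ≤ distFrom G d fuel u v
start≤distFrom G d zero       u v = ≤-refl
start≤distFrom G d (suc fuel) u v with within G d u v
... | true  = ≤-refl
... | false = ≤-trans (n≤1+n d) (start≤distFrom G (suc d) fuel u v)

dist≡1⇒adjacent : ∀ {n} (G : Graph n) {u v} → dist G u v ≡ 1 → T (G u v)
dist≡1⇒adjacent {suc zero} G {Fin.zero} {Fin.zero} ()
dist≡1⇒adjacent {suc (suc m)} G {u} {v} d≡1 with u Fin.≟ v
... | yes _ = contradiction d≡1 λ ()
... | no _ with any (λ w → G u w ∧ within G 0 w v) (allFin _)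
              | any⁻ (λ w → G u w ∧ within G 0 w v) (allFin _)
...   | false | _    = contradiction (subst (2 ≤_) d≡1 (start≤distFrom G 2 m u v)) λ { (s≤s ()) }
...   | true  | step = adjacentVia (satisfied (step _))
  where
  adjacentVia : ∃ (λ w → T (G u w ∧ within G 0 w v)) → T (G u v)
  adjacentVia (w , Guw∧w≡v) with Guw , w≡v ← Equivalence.to T-∧ Guw∧w≡v =
    subst (T ∘ G u) (toWitness w≡v) Guw

adjacent⇒dist≡1 : ∀ {n} (G : Graph n) {u v} → u ≢ v → T (G u v) → dist G u v ≡ 1
adjacent⇒dist≡1 {suc zero} G {Fin.zero} {Fin.zero} u≢v _ = contradiction refl u≢v
adjacent⇒dist≡1 {suc (suc m)} G {u} {v} u≢v Guv with u Fin.≟ v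
... | yes u≡v = contradiction u≡v u≢v
... | no _ with any (λ w → G u w ∧ within G 0 w v) (allFin _)
              | any⁺ (λ w → G u w ∧ within G 0 w v)
                     (Any.map (λ { refl → Equivalence.from T-∧ (Guv , fromWitness refl) }) (∈-allFin v))
...   | true  | _  = refl
...   | false | ()

∈-elems⁺ : ∀ {n} {S : Subset n} {s} → s ∈ S → s ∈ˡ elems S
∈-elems⁺ {s = s} s∈S = ∈-filter⁺ (_∈? _) (∈-allFin s) s∈S

∈-elems⁻ : ∀ {n} {S : Subset n} {s} → s ∈ˡ elems S → s ∈ S
∈-elems⁻ s∈S = proj₂ (∈-filter⁻ (_∈? _) {xs = allFin _} s∈S)

module _ {n} (G : Graph n) (S : Subset n) where

  atDistance : ℕ → Fin n → List (Fin n)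
  atDistance d v = filter (λ s → dist G v s ℕ.≟ d) (elems S)

  ~⇒|atDistance|≡ : ∀ {u v} → u ~[ G , S ] v → (d : Fin (suc n)) →
                    length (atDistance (toℕ d) u) ≡ length (atDistance (toℕ d) v)
  ~⇒|atDistance|≡ {u} {v} u~v d = begin
    length (atDistance (toℕ d) u)  ≡⟨ lookup∘tabulate (λ d → length (atDistance (toℕ d) u)) d ⟨
    Vec.lookup (mset G S u) d      ≡⟨ cong (λ m → Vec.lookup m d) u~v ⟩
    Vec.lookup (mset G S v) d      ≡⟨ lookup∘tabulate (λ d → length (atDistance (toℕ d) v)) d ⟩
    length (atDistance (toℕ d) v)  ∎
    where open ≡-Reasoning

  uniformDistance-resp-~ : ∀ {u v} → u ~[ G , S ] v → (d : Fin (suc n)) →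
                           All (λ s → dist G v s ≡ toℕ d) (elems S) →
                           All (λ s → dist G u s ≡ toℕ d) (elems S)
  uniformDistance-resp-~ {u} {v} u~v d v-uniform =
    subst (All _) atDistance-u-complete (all-filter (λ s → dist G u s ℕ.≟ toℕ d) (elems S))
    where
    atDistance-u-complete : atDistance (toℕ d) u ≡ elems S
    atDistance-u-complete = filter-complete (λ s → dist G u s ℕ.≟ toℕ d)
      (trans (~⇒|atDistance|≡ u~v d) (cong length (filter-all (λ s → dist G v s ℕ.≟ toℕ d) v-uniform)))

  classSize≤length : ∀ v {ys} → (∀ {u} → u ~[ G , S ] v → toℕ u ∈ˡ ys) → classSize G S v ≤ length ys
  classSize≤length v {ys} class⊆ys = begin
    length class             ≡⟨ length-map toℕ class ⟨
    length (map toℕ class)   ≤⟨ unique⊆⇒length≤ class! toℕ[class]⊆ys ⟩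
    length ys                ∎
    where
    open ≤-Reasoning
    _~v? = λ u → ≡-dec ℕ._≟_ (mset G S u) (mset G S v)
    outsideS = filter (λ u → ¬? (u ∈? S)) (allFin n)
    class = filter _~v? outsideS
    class! : Unique (map toℕ class)
    class! = Unique.map⁺ toℕ-injective (Unique.filter⁺ _ (Unique.filter⁺ _ (Unique.allFin⁺ n)))
    toℕ[class]⊆ys : map toℕ class ⊆ ys
    toℕ[class]⊆ys i∈ with u , u∈class , refl ← ∈-map⁻ toℕ i∈ =
      class⊆ys (proj₂ (∈-filter⁻ _~v? {xs = outsideS} u∈class))

cyclePred : ℕ → ℕ → ℕ
cyclePred n 1 = pred n
cyclePred n i = pred i

cycleSucc : ℕ → ℕ → ℕ
cycleSucc n i with suc i ℕ.≟ n
... | yes _ = 1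
... | no _  = suc i

rimNeighbours : ℕ → ℕ → List ℕ
rimNeighbours n i = 0 ∷ cyclePred n i ∷ cycleSucc n i ∷ []

wheel-hub-adjacent : ∀ n {i j} → i ≡ 0 → j ≢ 0 → T (wheelAdjℕ n i j)
wheel-hub-adjacent n {j = j} refl j≢0 with j ℕ.≟ 0
... | yes j≡0 = contradiction j≡0 j≢0
... | no _    = _

cycleSucc-last : ∀ {n i} → suc i ≡ n → cycleSucc n i ≡ 1
cycleSucc-last {n} {i} last with suc i ℕ.≟ n
... | yes _      = refl
... | no ¬last   = contradiction last ¬last

cycleSucc-inner : ∀ {n i} → suc i ≢ n → cycleSucc n i ≡ suc i
cycleSucc-inner {n} {i} ¬last with suc i ℕ.≟ n
... | yes last = contradiction last ¬last
... | no _     = refl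

toWitness-∧ : ∀ {p q} {P : Set p} {Q : Set q} (P? : Dec P) (Q? : Dec Q) → T (⌊ P? ⌋ ∧ ⌊ Q? ⌋) → P × Q
toWitness-∧ P? Q? = Product.map (toWitness {a? = P?}) (toWitness {a? = Q?}) ∘ Equivalence.to T-∧

rim-adjacency : ∀ n i j → T (wheelAdjℕ n (suc j) (suc i)) →
                suc i ≡ suc (suc j) ⊎ suc j ≡ suc (suc i)
                ⊎ (suc j ≡ 1 × suc (suc i) ≡ n) ⊎ (suc i ≡ 1 × suc (suc j) ≡ n)
rim-adjacency n i j adj with suc i ℕ.≟ suc (suc j)
... | yes i=j+1 = inj₁ i=j+1
... | no _ with suc j ℕ.≟ suc (suc i)
...   | yes j=i+1 = inj₂ (inj₁ j=i+1)
...   | no _ with Equivalence.to T-∨ adj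
...     | inj₁ closing = inj₂ (inj₂ (inj₁ (toWitness-∧ (suc j ℕ.≟ 1) (suc (suc i) ℕ.≟ n) closing)))
...     | inj₂ closing = inj₂ (inj₂ (inj₂ (toWitness-∧ (suc i ℕ.≟ 1) (suc (suc j) ℕ.≟ n) closing)))

wheel-rim-neighbour : ∀ n {i j} → i ≢ 0 → j < n → T (wheelAdjℕ n j i) → j ∈ˡ rimNeighbours n i
wheel-rim-neighbour n {zero}  i≢0 _ _ = contradiction refl i≢0
wheel-rim-neighbour n {suc i} {zero}  _ _   _   = here refl
wheel-rim-neighbour n {suc i} {suc j} _ j<n adj with rim-adjacency n i j adj
... | inj₁ refl                        = there (here refl)
... | inj₂ (inj₁ refl)                 = there (there (here (sym (cycleSucc-inner (<⇒≢ j<n)))))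
... | inj₂ (inj₂ (inj₁ (refl , last))) = there (there (here (sym (cycleSucc-last last))))
... | inj₂ (inj₂ (inj₂ (refl , last))) = there (here (cong pred last))

module _ {m} (S : Subset (suc m)) {hub} (hub≡0 : toℕ hub ≡ 0) (hub∉S : hub ∉ S) where

  private
    W = wheel (suc m)

    onRim : ∀ {s} → s ∈ S → toℕ s ≢ 0
    onRim s∈S s≡0 = hub∉S (subst (_∈ S) (toℕ-injective (trans s≡0 (sym hub≡0))) s∈S)

  hub-uniformDistance : All (λ s → dist W hub s ≡ 1) (elems S)
  hub-uniformDistance = All.tabulate λ s∈S →
    adjacent⇒dist≡1 W (λ { refl → hub∉S (∈-elems⁻ s∈S) })
                      (wheel-hub-adjacent (suc m) hub≡0 (onRim (∈-elems⁻ s∈S)))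

  hubClass-adjacent : ∀ {u s} → u ~[ W , S ] hub → s ∈ S → T (W u s)
  hubClass-adjacent u~hub s∈S = dist≡1⇒adjacent W
    (All.lookup (uniformDistance-resp-~ W S u~hub (Fin.suc Fin.zero) hub-uniformDistance) (∈-elems⁺ s∈S))

  hub-classSize≤3 : ∀ {s} → s ∈ S → classSize W S hub ≤ 3
  hub-classSize≤3 {s} s∈S = classSize≤length W S hub {rimNeighbours (suc m) (toℕ s)} λ {u} u~hub →
    wheel-rim-neighbour (suc m) (onRim s∈S) (toℕ<n u) (hubClass-adjacent u~hub s∈S)

lemma16 : (n : ℕ) → 7 ≤ n → (S : Subset n) (k : ℕ) →
          4 ≤ k → IsKMARS (wheel n) S k →
          (z : Fin n) → toℕ z ≡ 0 → z ∈ S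
lemma16 zero    _ _ _ _ _ ()
lemma16 (suc m) _ S k 4≤k ((s , s∈S) , _ , _ , k≤classSize) z z≡0 =
  decidable-stable (z ∈? S) λ z∉S →
    <⇒≱ (s≤s (hub-classSize≤3 S z≡0 z∉S s∈S)) (≤-trans 4≤k (k≤classSize z z∉S))
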